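{- Let $r\ge 2$ and let $H$ be an $r$-regular $r$-uniform hypergraph. Then $H$ is quasi-eulerian.
   Context: A hypergraph $H=(V,E)$ has a nonempty finite vertex set $V$ and a finite set $E$ of edges, each associated with a subset of $V$ (parallel edges allowed). $H$ is $r$-regular if every vertex lies in exactly $r$ edges, and $r$-uniform if every edge has exactly $r$ vertices. A walk is $v_0e_1v_1\dots e_kv_k$ with $v_{i-1}\ne v_i$, $v_{i-1},v_i\in e_i$; anchors $v_0,\dots,v_k$; closed if $k\ge2$ and $v_0=v_k$; a strict trail if $e_1,\dots,e_k$ are pairwise distinct. An Euler family is a family of pairwise anchor-disjoint closed strict trails such that each edge lies in exactly one of them; $H$ is quasi-eulerian if it admits one. -}

module Defs where

open import Data.Nat using (ℕ; suc; _≥_)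
open import Data.Fin using (Fin)
open import Data.Fin.Subset using (Subset; _∈_; ∣_∣)
open import Data.Fin.Subset.Properties using (_∈?_)
open import Data.List using (List; []; _∷_; map; length; filter; allFin; lookup)
open import Data.List.Relation.Unary.Unique.Propositional using (Unique)
open import Data.List.Relation.Unary.AllPairs using (AllPairs)
import Data.List.Membership.Propositional as L
open import Data.Product using (Σ; _×_; _,_; proj₁; proj₂)
open import Relation.Binary.PropositionalEquality using (_≡_; _≢_)
open import Relation.Nullary using (¬_)

-- Parallel edges are allowed (edge need not be injective).
record Hypergraph : Set where
  field
    nv   : ℕ          -- |V| - 1, so V = Fin (suc nv) is nonempty
    ne   : ℕ
    edge : Fin ne → Subset (suc nv)

module _ (H : Hypergraph) where
  open Hypergraph H

  V : Set
  V = Fin (suc nv)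

  E : Set
  E = Fin ne

  degree : V → ℕ
  degree v = length (filter (λ e → v ∈? edge e) (allFin ne))

  Regular : ℕ → Set
  Regular r = ∀ v → degree v ≡ r

  Uniform : ℕ → Set
  Uniform r = ∀ e → ∣ edge e ∣ ≡ r

  -- A walk v0 e1 v1 ... ek vk is given by v0 and the list of steps (e_i , v_i).
  record Walk : Set where
    constructor walk
    field
      start : V
      steps : List (E × V)

  data ValidSteps : V → List (E × V) → Set where
    []  : ∀ {u} → ValidSteps u []
    _∷_ : ∀ {u e w s} → (u ≢ w) × (u ∈ edge e) × (w ∈ edge e) →
          ValidSteps w s → ValidSteps u ((e , w) ∷ s)

  anchors : Walk → List V
  anchors (walk v0 s) = v0 ∷ map proj₂ s

  edgesOf : Walk → List E
  edgesOf (walk _ s) = map proj₁ s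

  endpoint : V → List (E × V) → V
  endpoint u []            = u
  endpoint u ((_ , w) ∷ s) = endpoint w s

  IsWalk : Walk → Set
  IsWalk (walk v0 s) = ValidSteps v0 s

  IsClosed : Walk → Set
  IsClosed (walk v0 s) = (length s ≥ 2) × (endpoint v0 s ≡ v0)

  IsStrictTrail : Walk → Set
  IsStrictTrail w = IsWalk w × Unique (edgesOf w)

  IsClosedStrictTrail : Walk → Set
  IsClosedStrictTrail w = IsStrictTrail w × IsClosed w

  AnchorDisjoint : Walk → Walk → Set
  AnchorDisjoint t₁ t₂ = ∀ v → v L.∈ anchors t₁ → ¬ (v L.∈ anchors t₂)

  IsEulerFamily : List Walk → Set
  IsEulerFamily F =
    ((i : Fin (length F)) → IsClosedStrictTrail (lookup F i)) ×
    (∀ (i j : Fin (length F)) → i ≢ j → AnchorDisjoint (lookup F i) (lookup F j)) ×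
    (∀ (e : E) → Σ (Fin (length F)) λ i →
        (e L.∈ edgesOf (lookup F i)) ×
        (∀ j → e L.∈ edgesOf (lookup F j) → j ≡ i))

  QuasiEulerian : Set
  QuasiEulerian = Σ (List Walk) IsEulerFamily

-- The incidence relation of H (vertices against edges) is r-regular on both sides, so
-- Hall's condition holds by double counting and there are injective matchings V → E and
-- E → V; hence |V| = |E| and the matching σ : V → E is a bijection.  Deleting σ
-- leaves an (r − 1)-regular relation, r − 1 ≥ 1, with a second bijection τ disjoint from σ.
-- The permutation π = σ⁻¹ ∘ τ of V has no fixed point and v, π v both lie in the edge τ v,
-- so each cycle of π, walked along the edges τ v, is a closed strict trail.  Distinct cycles
-- share no anchor, and every edge τ v lies on the cycle of v only.

module Submission where

open import Defs
open import Data.Nat using (ℕ; _≥_)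

open import Data.Bool using (if_then_else_)
open import Data.Fin using (Fin; zero; suc; toℕ; fromℕ<; punchOut) renaming (_≤_ to _≤ᶠ_; _≤?_ to _≤ᶠ?_)
open import Data.Fin.Properties
  using (_≟_; any?; all?; ¬∀⟶∃¬; pigeonhole; toℕ<n; toℕ-fromℕ<; punchOut-injective; injective⇒≤;
         cantor-schröder-bernstein)
  renaming (≤-antisym to ≤ᶠ-antisym)
open import Data.Fin.Subset
  using (Subset; _∈_; _∉_; _⊆_; _⊂_; _∪_; _∩_; _─_; _-_; ⁅_⁆; ∣_∣; Nonempty; Empty; inside; outside; ⊤)
open import Data.Fin.Subset.Properties
  using (_∈?_; _⊂?_; nonempty?; anySubset?; Empty-unique; ∣⊥∣≡0; ∣⁅x⁆∣≡1; p⊆q⇒∣p∣≤∣q∣; p⊂q⇒∣p∣<∣q∣;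
         p∩q≢∅⇒∣p─q∣<∣p∣; x∈p⇒∣p-x∣<∣p∣; x∈p∩q⁺; x∈p∩q⁻; x∈p∪q⁺; x∈p∪q⁻; p─q⊆p; x∈p∧x∉q⇒x∈p─q;
         x∈p∧x≢y⇒x∈p-y; x∈⁅x⁆; x∈⁅y⁆⇒x≡y; ∈⊤)
open import Data.List using (List; []; _∷_; map; length; filter; tabulate; allFin; lookup)
import Data.List.Membership.Propositional as List
open import Data.List.Membership.Propositional.Properties
  using (∈-lookup; ∈-map⁺; ∈-map⁻; ∈-filter⁺; ∈-filter⁻; ∈-allFin)
import Data.List.Relation.Unary.All as All
open import Data.List.Relation.Unary.AllPairs using ([]; _∷_)
open import Data.List.Relation.Unary.Any using (here; there; index)
open import Data.List.Relation.Unary.Any.Properties using (lookup-index)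
open import Data.List.Relation.Unary.Unique.Propositional using (Unique)
import Data.List.Relation.Unary.Unique.Propositional.Properties as Unique
open import Data.Nat
  using (zero; suc; _+_; _*_; _∸_; _≤_; _<_; _≤?_; _<?_; _%_; _/_; z≤n; s≤s; NonZero; >-nonZero)
open import Data.Nat.DivMod using (m≡m%n+[m/n]*n; m%n<n)
open import Data.Nat.GeneralisedArithmetic using (iterate)
open import Data.Nat.Induction using (<-wellFounded)
open import Data.Nat.Properties hiding (_≟_)
open import Algebra.Properties.Semiring.Sum +-*-semiring
  using (sum; sum-syntax; ∑-comm; sum-cong-≗; sum-replicate-zero; *-distribˡ-sum)
open import Data.Product using (Σ; ∃; _×_; _,_; proj₁; proj₂)
open import Data.Sum using (inj₁; inj₂)
open import Data.Vec using ([]; _∷_; here; there)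
open import Function using (_∘_; flip)
open import Function.Definitions using (Injective)
open import Induction.WellFounded using (Acc; acc)
open import Level using (0ℓ)
open import Relation.Binary.Core using (REL)
open import Relation.Binary.Definitions using (Decidable; tri<; tri≈; tri>)
open import Relation.Binary.PropositionalEquality
open import Relation.Nullary using (Dec; does; yes; no; ¬_; ¬?; contradiction; _×-dec_; map′)
import Relation.Unary as U

private variable
  n : ℕ

-- Counting with indicators and subsets

indicator : ∀ {a} {A : Set a} → Dec A → ℕ
indicator a? = if does a? then 1 else 0

indicator-mono : ∀ {a b} {A : Set a} {B : Set b} → (A → B) → (a? : Dec A) (b? : Dec B) →
                 indicator a? ≤ indicator b?
indicator-mono A→B (no _)  _       = z≤n
indicator-mono A→B (yes a) (yes _) = ≤-refl
indicator-mono A→B (yes a) (no ¬b) = contradiction (A→B a) ¬b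

indicator-¬ : ∀ {a} {A : Set a} → ¬ A → (a? : Dec A) → indicator a? ≡ 0
indicator-¬ ¬a (no _)  = refl
indicator-¬ ¬a (yes a) = contradiction a ¬a

∑-mono-≤ : {f g : Fin n → ℕ} → (∀ i → f i ≤ g i) → sum f ≤ sum g
∑-mono-≤ {zero}  f≤g = z≤n
∑-mono-≤ {suc n} f≤g = +-mono-≤ (f≤g zero) (∑-mono-≤ (λ i → f≤g (suc i)))

setOf : ∀ {ℓ} {P : U.Pred (Fin n) ℓ} → U.Decidable P → Subset n
setOf {zero}  P? = []
setOf {suc n} P? = does (P? zero) ∷ setOf (λ i → P? (suc i))

∈-setOf⁺ : ∀ {ℓ} {P : U.Pred (Fin n) ℓ} (P? : U.Decidable P) {x} → P x → x ∈ setOf P?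
∈-setOf⁺ P? {zero} Px with P? zero
... | yes _  = here
... | no ¬Px = contradiction Px ¬Px
∈-setOf⁺ P? {suc x} Px = there (∈-setOf⁺ (λ i → P? (suc i)) Px)

∈-setOf⁻ : ∀ {ℓ} {P : U.Pred (Fin n) ℓ} (P? : U.Decidable P) {x} → x ∈ setOf P? → P x
∈-setOf⁻ P? {zero} x∈ with P? zero | x∈
... | yes Px | _ = Px
∈-setOf⁻ P? {suc x} (there x∈) = ∈-setOf⁻ (λ i → P? (suc i)) x∈

∣p∣≡∑ : (p : Subset n) → ∣ p ∣ ≡ ∑[ i < n ] indicator (i ∈? p)
∣p∣≡∑ []            = refl
∣p∣≡∑ (inside  ∷ p) = cong suc (∣p∣≡∑ p)
∣p∣≡∑ (outside ∷ p) = ∣p∣≡∑ p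

∣setOf∣≡∑ : ∀ {ℓ} {P : U.Pred (Fin n) ℓ} (P? : U.Decidable P) →
            ∣ setOf P? ∣ ≡ ∑[ i < n ] indicator (P? i)
∣setOf∣≡∑ {zero}  P? = refl
∣setOf∣≡∑ {suc n} P? with P? zero
... | yes _ = cong suc (∣setOf∣≡∑ (λ i → P? (suc i)))
... | no  _ = ∣setOf∣≡∑ (λ i → P? (suc i))

length-filter-tabulate : ∀ {n} {A : Set} {P : U.Pred A 0ℓ} (P? : U.Decidable P) (f : Fin n → A) →
                         length (filter P? (tabulate f)) ≡ ∣ setOf (λ i → P? (f i)) ∣
length-filter-tabulate {zero}  P? f = refl
length-filter-tabulate {suc n} P? f with P? (f zero)
... | yes _ = cong suc (length-filter-tabulate P? (λ i → f (suc i)))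
... | no  _ = length-filter-tabulate P? (λ i → f (suc i))

∣p∪q∣+∣p∩q∣≡∣p∣+∣q∣ : (p q : Subset n) → ∣ p ∪ q ∣ + ∣ p ∩ q ∣ ≡ ∣ p ∣ + ∣ q ∣
∣p∪q∣+∣p∩q∣≡∣p∣+∣q∣ []            []            = refl
∣p∪q∣+∣p∩q∣≡∣p∣+∣q∣ (inside  ∷ p) (inside  ∷ q) =
  cong suc (trans (+-suc _ _) (trans (cong suc (∣p∪q∣+∣p∩q∣≡∣p∣+∣q∣ p q)) (sym (+-suc _ _))))
∣p∪q∣+∣p∩q∣≡∣p∣+∣q∣ (inside  ∷ p) (outside ∷ q) = cong suc (∣p∪q∣+∣p∩q∣≡∣p∣+∣q∣ p q)
∣p∪q∣+∣p∩q∣≡∣p∣+∣q∣ (outside ∷ p) (inside  ∷ q) =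
  trans (cong suc (∣p∪q∣+∣p∩q∣≡∣p∣+∣q∣ p q)) (sym (+-suc _ _))
∣p∪q∣+∣p∩q∣≡∣p∣+∣q∣ (outside ∷ p) (outside ∷ q) = ∣p∪q∣+∣p∩q∣≡∣p∣+∣q∣ p q

Empty⇒∣p∣≡0 : {p : Subset n} → Empty p → ∣ p ∣ ≡ 0
Empty⇒∣p∣≡0 {n} empty rewrite Empty-unique empty = ∣⊥∣≡0 n

∣p∣>0⇒Nonempty : (p : Subset n) → 0 < ∣ p ∣ → Nonempty p
∣p∣>0⇒Nonempty p ∣p∣>0 with nonempty? p
... | yes nonempty = nonempty
... | no  empty    = contradiction (Empty⇒∣p∣≡0 empty) (>⇒≢ ∣p∣>0)

∣p∪q∣≤∣p∣+∣q∣ : (p q : Subset n) → ∣ p ∪ q ∣ ≤ ∣ p ∣ + ∣ q ∣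
∣p∪q∣≤∣p∣+∣q∣ p q = subst (∣ p ∪ q ∣ ≤_) (∣p∪q∣+∣p∩q∣≡∣p∣+∣q∣ p q) (m≤m+n _ _)

Empty[p∩q]⇒∣p∪q∣≡∣p∣+∣q∣ : (p q : Subset n) → Empty (p ∩ q) → ∣ p ∪ q ∣ ≡ ∣ p ∣ + ∣ q ∣
Empty[p∩q]⇒∣p∪q∣≡∣p∣+∣q∣ p q empty = begin
  ∣ p ∪ q ∣               ≡⟨ +-identityʳ _ ⟨
  ∣ p ∪ q ∣ + 0           ≡⟨ cong (∣ p ∪ q ∣ +_) (Empty⇒∣p∣≡0 empty) ⟨
  ∣ p ∪ q ∣ + ∣ p ∩ q ∣   ≡⟨ ∣p∪q∣+∣p∩q∣≡∣p∣+∣q∣ p q ⟩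
  ∣ p ∣ + ∣ q ∣           ∎
  where open ≡-Reasoning

p⊆q∪r⇒∣p∣≤∣q∣+∣r∣ : {p : Subset n} (q r : Subset n) → p ⊆ q ∪ r → ∣ p ∣ ≤ ∣ q ∣ + ∣ r ∣
p⊆q∪r⇒∣p∣≤∣q∣+∣r∣ q r p⊆q∪r = ≤-trans (p⊆q⇒∣p∣≤∣q∣ p⊆q∪r) (∣p∪q∣≤∣p∣+∣q∣ q r)

x∈p─q⇒x∉q : ∀ {x} (p q : Subset n) → x ∈ p ─ q → x ∉ q
x∈p─q⇒x∉q (inside ∷ p) (outside ∷ q) here       ()
x∈p─q⇒x∉q (_ ∷ p)      (_ ∷ q)       (there x∈) (there x∈q) = x∈p─q⇒x∉q p q x∈ x∈q

-- Hall's theorem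

module _ {a b : ℕ} where

  neighbours : {R : REL (Fin a) (Fin b) 0ℓ} → Decidable R → Subset a → Subset b
  neighbours R? S = setOf (λ j → any? (λ i → i ∈? S ×-dec R? i j))

  module _ {R : REL (Fin a) (Fin b) 0ℓ} (R? : Decidable R) {S : Subset a} where

    ∈-neighbours⁺ : ∀ {i j} → i ∈ S → R i j → j ∈ neighbours R? S
    ∈-neighbours⁺ i∈S Rij = ∈-setOf⁺ _ (_ , i∈S , Rij)

    ∈-neighbours⁻ : ∀ {j} → j ∈ neighbours R? S → ∃ λ i → i ∈ S × R i j
    ∈-neighbours⁻ = ∈-setOf⁻ _

  record Matching (R : REL (Fin a) (Fin b) 0ℓ) (A : Subset a) : Set where
    field
      partner           : Fin a → Fin b
      partner-related   : ∀ {i} → i ∈ A → R i (partner i)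
      partner-injective : ∀ {i i′} → i ∈ A → i′ ∈ A → partner i ≡ partner i′ → i ≡ i′

  HallCondition : {R : REL (Fin a) (Fin b) 0ℓ} → Decidable R → Subset a → Set
  HallCondition R? A = ∀ {S} → S ⊆ A → ∣ S ∣ ≤ ∣ neighbours R? S ∣

  module _ {R : REL (Fin a) (Fin b) 0ℓ} (R? : Decidable R) where

    HallCondition-⊆ : ∀ {A B} → A ⊆ B → HallCondition R? B → HallCondition R? A
    HallCondition-⊆ A⊆B hallB S⊆A = hallB (λ x∈S → A⊆B (S⊆A x∈S))

    HallCondition⇒related : ∀ {A i} → i ∈ A → HallCondition R? A → ∃ λ j → R i j
    HallCondition⇒related {A} {i} i∈A hallA =
      let j , j∈N           = ∣p∣>0⇒Nonempty (neighbours R? ⁅ i ⁆)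
                                  (subst (_≤ ∣ neighbours R? ⁅ i ⁆ ∣) (∣⁅x⁆∣≡1 i) (hallA ⁅i⁆⊆A))
          i′ , i′∈⁅i⁆ , Ri′j = ∈-neighbours⁻ R? j∈N
      in  j , subst (λ x → R x j) (x∈⁅y⁆⇒x≡y i i′∈⁅i⁆) Ri′j
      where
      ⁅i⁆⊆A : ⁅ i ⁆ ⊆ A
      ⁅i⁆⊆A x∈⁅i⁆ = subst (_∈ A) (sym (x∈⁅y⁆⇒x≡y i x∈⁅i⁆)) i∈A

    Critical : Subset a → Subset a → Set
    Critical A S = S ⊂ A × Nonempty S × ∣ neighbours R? S ∣ ≤ ∣ S ∣

    critical? : ∀ A S → Dec (Critical A S)
    critical? A S = S ⊂? A ×-dec nonempty? S ×-dec ∣ neighbours R? S ∣ ≤? ∣ S ∣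

    module _ {A S : Subset a} (S⊆A : S ⊆ A) where

      OutsideNeighbours : REL (Fin a) (Fin b) 0ℓ
      OutsideNeighbours i j = R i j × j ∉ neighbours R? S

      outsideNeighbours? : Decidable OutsideNeighbours
      outsideNeighbours? i j = R? i j ×-dec ¬? (j ∈? neighbours R? S)

      HallCondition-outsideCritical : HallCondition R? A → ∣ neighbours R? S ∣ ≤ ∣ S ∣ →
                             HallCondition outsideNeighbours? (A ─ S)
      HallCondition-outsideCritical hallA tight {T} T⊆A─S = +-cancelʳ-≤ ∣ S ∣ ∣ T ∣ _ (begin
        ∣ T ∣ + ∣ S ∣                       ≡⟨ Empty[p∩q]⇒∣p∪q∣≡∣p∣+∣q∣ T S disjoint ⟨
        ∣ T ∪ S ∣                           ≤⟨ hallA T∪S⊆A ⟩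
        ∣ neighbours R? (T ∪ S) ∣           ≤⟨ p⊆q∪r⇒∣p∣≤∣q∣+∣r∣ _ _ cover ⟩
        ∣ N′ T ∣ + ∣ neighbours R? S ∣      ≤⟨ +-monoʳ-≤ ∣ N′ T ∣ tight ⟩
        ∣ N′ T ∣ + ∣ S ∣                    ∎)
        where
        open ≤-Reasoning
        N′ : Subset a → Subset b
        N′ = neighbours outsideNeighbours?

        disjoint : Empty (T ∩ S)
        disjoint (x , x∈T∩S) with x∈p∩q⁻ T S x∈T∩S
        ... | x∈T , x∈S = x∈p─q⇒x∉q A S (T⊆A─S x∈T) x∈S

        T∪S⊆A : T ∪ S ⊆ A
        T∪S⊆A x∈T∪S with x∈p∪q⁻ T S x∈T∪S
        ... | inj₁ x∈T = p─q⊆p A S (T⊆A─S x∈T)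
        ... | inj₂ x∈S = S⊆A x∈S

        cover : neighbours R? (T ∪ S) ⊆ N′ T ∪ neighbours R? S
        cover {j} j∈N[T∪S] with ∈-neighbours⁻ R? j∈N[T∪S] | j ∈? neighbours R? S
        ... | _ | yes j∈N[S] = x∈p∪q⁺ (inj₂ j∈N[S])
        ... | i , i∈T∪S , Rij | no j∉N[S] with x∈p∪q⁻ T S i∈T∪S
        ...   | inj₁ i∈T = x∈p∪q⁺ (inj₁ (∈-neighbours⁺ outsideNeighbours? i∈T (Rij , j∉N[S])))
        ...   | inj₂ i∈S = contradiction (∈-neighbours⁺ R? i∈S Rij) j∉N[S]

      glueAtCritical : Matching R S → Matching OutsideNeighbours (A ─ S) → Matching R A
      glueAtCritical inner outer = record
        { partner = partner ; partner-related = related ; partner-injective = injective }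
        where
        module I = Matching inner
        module O = Matching outer

        partner : Fin a → Fin b
        partner i with i ∈? S
        ... | yes _ = I.partner i
        ... | no  _ = O.partner i

        related : ∀ {i} → i ∈ A → R i (partner i)
        related {i} i∈A with i ∈? S
        ... | yes i∈S = I.partner-related i∈S
        ... | no  i∉S = proj₁ (O.partner-related (x∈p∧x∉q⇒x∈p─q i∈A i∉S))

        separated : ∀ {i i′} → i ∈ S → i′ ∈ A → i′ ∉ S → I.partner i ≢ O.partner i′
        separated i∈S i′∈A i′∉S eq = proj₂ (O.partner-related (x∈p∧x∉q⇒x∈p─q i′∈A i′∉S))
          (subst (_∈ neighbours R? S) eq (∈-neighbours⁺ R? i∈S (I.partner-related i∈S)))

        injective : ∀ {i i′} → i ∈ A → i′ ∈ A → partner i ≡ partner i′ → i ≡ i′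
        injective {i} {i′} i∈A i′∈A with i ∈? S | i′ ∈? S
        ... | yes i∈S | yes i′∈S = I.partner-injective i∈S i′∈S
        ... | yes i∈S | no  i′∉S = λ eq → contradiction eq (separated i∈S i′∈A i′∉S)
        ... | no  i∉S | yes i′∈S = λ eq → contradiction (sym eq) (separated i′∈S i∈A i∉S)
        ... | no  i∉S | no  i′∉S =
          O.partner-injective (x∈p∧x∉q⇒x∈p─q i∈A i∉S) (x∈p∧x∉q⇒x∈p─q i′∈A i′∉S)

    module _ {A : Subset a} {i : Fin a} {j : Fin b} (i∈A : i ∈ A) (Rij : R i j) where

      WithoutColumn : REL (Fin a) (Fin b) 0ℓ
      WithoutColumn x y = R x y × y ≢ j

      withoutColumn? : Decidable WithoutColumn
      withoutColumn? x y = R? x y ×-dec ¬? (y ≟ j)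

      HallCondition-withoutColumn : HallCondition R? A → (∀ S → ¬ Critical A S) →
                                    HallCondition withoutColumn? (A - i)
      HallCondition-withoutColumn hallA noCritical {T} T⊆A-i with nonempty? T
      ... | no  empty    = ≤-trans (≤-reflexive (Empty⇒∣p∣≡0 empty)) z≤n
      ... | yes nonempty = ≤-pred (begin-strict
        ∣ T ∣                        <⟨ ≰⇒> (λ tight → noCritical T (T⊂A , nonempty , tight)) ⟩
        ∣ neighbours R? T ∣          ≤⟨ p⊆q∪r⇒∣p∣≤∣q∣+∣r∣ _ _ cover ⟩
        ∣ N′ T ∣ + ∣ ⁅ j ⁆ ∣         ≡⟨ cong (∣ N′ T ∣ +_) (∣⁅x⁆∣≡1 j) ⟩
        ∣ N′ T ∣ + 1                 ≡⟨ +-comm ∣ N′ T ∣ 1 ⟩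
        suc ∣ N′ T ∣                 ∎)
        where
        open ≤-Reasoning
        N′ : Subset a → Subset b
        N′ = neighbours withoutColumn?

        T⊂A : T ⊂ A
        T⊂A = (λ x∈T → p─q⊆p A ⁅ i ⁆ (T⊆A-i x∈T)) , i , i∈A ,
              (λ i∈T → x∈p─q⇒x∉q A ⁅ i ⁆ (T⊆A-i i∈T) (x∈⁅x⁆ i))

        cover : neighbours R? T ⊆ N′ T ∪ ⁅ j ⁆
        cover {y} y∈N[T] with ∈-neighbours⁻ R? y∈N[T] | y ≟ j
        ... | _              | yes refl = x∈p∪q⁺ (inj₂ (x∈⁅x⁆ j))
        ... | x , x∈T , Rxy  | no  y≢j  = x∈p∪q⁺ (inj₁ (∈-neighbours⁺ withoutColumn? x∈T (Rxy , y≢j)))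

      extendByPartner : Matching WithoutColumn (A - i) → Matching R A
      extendByPartner rest = record
        { partner = partner ; partner-related = related ; partner-injective = injective }
        where
        module M = Matching rest

        partner : Fin a → Fin b
        partner x with x ≟ i
        ... | yes _ = j
        ... | no  _ = M.partner x

        related : ∀ {x} → x ∈ A → R x (partner x)
        related {x} x∈A with x ≟ i
        ... | yes refl = Rij
        ... | no  x≢i  = proj₁ (M.partner-related (x∈p∧x≢y⇒x∈p-y x∈A x≢i))

        partner≢j : ∀ {x} → x ∈ A → x ≢ i → M.partner x ≢ j
        partner≢j x∈A x≢i = proj₂ (M.partner-related (x∈p∧x≢y⇒x∈p-y x∈A x≢i))

        injective : ∀ {x x′} → x ∈ A → x′ ∈ A → partner x ≡ partner x′ → x ≡ x′
        injective {x} {x′} x∈A x′∈A with x ≟ i | x′ ≟ i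
        ... | yes refl | yes refl = λ _ → refl
        ... | yes refl | no  x′≢i = λ eq → contradiction (sym eq) (partner≢j x′∈A x′≢i)
        ... | no  x≢i  | yes refl = λ eq → contradiction eq (partner≢j x∈A x≢i)
        ... | no  x≢i  | no  x′≢i =
          M.partner-injective (x∈p∧x≢y⇒x∈p-y x∈A x≢i) (x∈p∧x≢y⇒x∈p-y x′∈A x′≢i)

  -- A critical set S splits A into S, matched inside its neighbourhood, and A ─ S, matched
  -- outside it.  Without one, any i ∈ A may take any related j: deleting both keeps Hall's
  -- condition, since every nonempty proper subset had a surplus of neighbours.
  hallMatching : Fin b → ∀ {R} (R? : Decidable R) (A : Subset a) → Acc _<_ ∣ A ∣ →
                 HallCondition R? A → Matching R A
  hallMatching default R? A (acc rec) hallA with anySubset? (critical? R? A)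
  ... | yes (S , S⊂A@(S⊆A , _) , nonempty@(x , x∈S) , tight) =
    glueAtCritical R? S⊆A
      (hallMatching default R? S (rec (p⊂q⇒∣p∣<∣q∣ S⊂A)) (HallCondition-⊆ R? S⊆A hallA))
      (hallMatching default (outsideNeighbours? R? S⊆A) (A ─ S)
        (rec (p∩q≢∅⇒∣p─q∣<∣p∣ A S (x , x∈p∩q⁺ (S⊆A x∈S , x∈S))))
        (HallCondition-outsideCritical R? S⊆A hallA tight))
  ... | no noCritical with nonempty? A
  ...   | yes (i , i∈A) =
    let j , Rij = HallCondition⇒related R? i∈A hallA in
    extendByPartner R? i∈A Rij
      (hallMatching default (withoutColumn? R? i∈A Rij) (A - i) (rec (x∈p⇒∣p-x∣<∣p∣ i∈A))
        (HallCondition-withoutColumn R? i∈A Rij hallA (λ S critical → noCritical (S , critical))))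
  ...   | no empty = record
    { partner           = λ _ → default
    ; partner-related   = λ i∈A → contradiction (_ , i∈A) empty
    ; partner-injective = λ i∈A _ _ → contradiction (_ , i∈A) empty
    }

hall : ∀ {a b} {R : REL (Fin a) (Fin b) 0ℓ} (R? : Decidable R) → HallCondition R? ⊤ →
       ∃ λ (f : Fin a → Fin b) → (∀ i → R i (f i)) × Injective _≡_ _≡_ f
hall {zero}  R? hall⊤ = (λ ()) , (λ ()) , λ {i} → contradiction i λ ()
hall {suc a} {b} R? hall⊤ = partner , (λ i → partner-related ∈⊤) , partner-injective ∈⊤ ∈⊤
  where
  default : Fin b
  default = proj₁ (HallCondition⇒related R? (∈⊤ {x = zero}) hall⊤)

  open Matching (hallMatching default R? ⊤ (<-wellFounded _) hall⊤)

module _ {a b : ℕ} {R : REL (Fin a) (Fin b) 0ℓ} (R? : Decidable R) where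

  row : Fin a → Subset b
  row i = setOf (R? i)

  column : Fin b → Subset a
  column j = setOf (λ i → R? i j)

  biregular⇒HallCondition : ∀ k .{{_ : NonZero k}} → (∀ i → k ≤ ∣ row i ∣) → (∀ j → ∣ column j ∣ ≤ k) →
                            HallCondition R? ⊤
  biregular⇒HallCondition k k≤∣row∣ ∣column∣≤k {S} _ = *-cancelˡ-≤ k (begin
    k * ∣ S ∣                                  ≡⟨ cong (k *_) (∣p∣≡∑ S) ⟩
    k * ∑[ i < a ] indicator (i ∈? S)          ≡⟨ *-distribˡ-sum k (λ i → indicator (i ∈? S)) ⟩
    ∑[ i < a ] (k * indicator (i ∈? S))        ≤⟨ ∑-mono-≤ rowBound ⟩
    ∑[ i < a ] ∑[ j < b ] indicator (linked? i j)  ≡⟨ ∑-comm (λ i j → indicator (linked? i j)) ⟩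
    ∑[ j < b ] ∑[ i < a ] indicator (linked? i j)  ≤⟨ ∑-mono-≤ columnBound ⟩
    ∑[ j < b ] (k * indicator (adjacent? j))   ≡⟨ *-distribˡ-sum k (λ j → indicator (adjacent? j)) ⟨
    k * ∑[ j < b ] indicator (adjacent? j)     ≡⟨ cong (k *_) (∣setOf∣≡∑ adjacent?) ⟨
    k * ∣ neighbours R? S ∣                    ∎)
    where
    open ≤-Reasoning
    linked? : ∀ i j → Dec (i ∈ S × R i j)
    linked? i j = i ∈? S ×-dec R? i j

    adjacent? : ∀ j → Dec (∃ λ i → i ∈ S × R i j)
    adjacent? j = any? (λ i → linked? i j)

    rowBound : ∀ i → k * indicator (i ∈? S) ≤ ∑[ j < b ] indicator (linked? i j)
    rowBound i with i ∈? S
    ... | no  _ = ≤-trans (≤-reflexive (*-zeroʳ k)) z≤n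
    ... | yes _ = begin
      k * 1                          ≡⟨ *-identityʳ k ⟩
      k                              ≤⟨ k≤∣row∣ i ⟩
      ∣ row i ∣                      ≡⟨ ∣setOf∣≡∑ (R? i) ⟩
      ∑[ j < b ] indicator (R? i j)  ∎

    columnBound : ∀ j → ∑[ i < a ] indicator (linked? i j) ≤ k * indicator (adjacent? j)
    columnBound j with adjacent? j
    ... | yes _ = begin
      ∑[ i < a ] indicator (linked? i j)  ≤⟨ ∑-mono-≤ (λ i → indicator-mono proj₂ (linked? i j) (R? i j)) ⟩
      ∑[ i < a ] indicator (R? i j)     ≡⟨ ∣setOf∣≡∑ (λ i → R? i j) ⟨
      ∣ column j ∣                      ≤⟨ ∣column∣≤k j ⟩
      k                                 ≡⟨ *-identityʳ k ⟨
      k * 1                             ∎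
    ... | no  ¬adjacent = begin
      ∑[ i < a ] indicator (linked? i j)  ≡⟨ sum-cong-≗ (λ i → indicator-¬ (¬adjacent ∘ (i ,_)) (linked? i j)) ⟩
      ∑[ i < a ] 0                      ≡⟨ sum-replicate-zero a ⟩
      0                                 ≡⟨ *-zeroʳ k ⟨
      k * 0                             ∎

  biregularMatching : ∀ k .{{_ : NonZero k}} → (∀ i → k ≤ ∣ row i ∣) → (∀ j → ∣ column j ∣ ≤ k) →
                      ∃ λ (f : Fin a → Fin b) → (∀ i → R i (f i)) × Injective _≡_ _≡_ f
  biregularMatching k rows columns = hall R? (biregular⇒HallCondition k rows columns)

module _ {a b : ℕ} {R : REL (Fin a) (Fin b) 0ℓ} (R? : Decidable R) (σ : Fin a → Fin b) where

  AvoidingMatching : REL (Fin a) (Fin b) 0ℓ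
  AvoidingMatching i j = R i j × j ≢ σ i

  avoidingMatching? : Decidable AvoidingMatching
  avoidingMatching? i j = R? i j ×-dec ¬? (j ≟ σ i)

  ∣row∣-avoidingMatching : ∀ i → ∣ row R? i ∣ ≤ suc ∣ row avoidingMatching? i ∣
  ∣row∣-avoidingMatching i = begin
    ∣ row R? i ∣             ≤⟨ p⊆q∪r⇒∣p∣≤∣q∣+∣r∣ (row avoidingMatching? i) ⁅ σ i ⁆ cover ⟩
    ∣ row′ ∣ + ∣ ⁅ σ i ⁆ ∣   ≡⟨ cong (∣ row′ ∣ +_) (∣⁅x⁆∣≡1 (σ i)) ⟩
    ∣ row′ ∣ + 1             ≡⟨ +-comm ∣ row′ ∣ 1 ⟩
    suc ∣ row′ ∣             ∎
    where
    open ≤-Reasoning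
    row′ : Subset b
    row′ = row avoidingMatching? i

    cover : row R? i ⊆ row′ ∪ ⁅ σ i ⁆
    cover {j} j∈row with j ≟ σ i
    ... | yes refl = x∈p∪q⁺ (inj₂ (x∈⁅x⁆ (σ i)))
    ... | no  j≢σi = x∈p∪q⁺ (inj₁ (∈-setOf⁺ (avoidingMatching? i) (∈-setOf⁻ (R? i) j∈row , j≢σi)))

  ∣column∣-avoidingMatching : (∀ i → R i (σ i)) → (∀ j → ∃ λ i → σ i ≡ j) →
                              ∀ j → ∣ column avoidingMatching? j ∣ < ∣ column R? j ∣
  ∣column∣-avoidingMatching σ-related σ-surjective j with σ-surjective j
  ... | i₀ , refl = begin-strict
    ∣ column avoidingMatching? (σ i₀) ∣  ≤⟨ p⊆q⇒∣p∣≤∣q∣ shrink ⟩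
    ∣ column R? (σ i₀) - i₀ ∣            <⟨ x∈p⇒∣p-x∣<∣p∣ (∈-setOf⁺ (λ i → R? i (σ i₀)) (σ-related i₀)) ⟩
    ∣ column R? (σ i₀) ∣                 ∎
    where
    open ≤-Reasoning
    shrink : column avoidingMatching? (σ i₀) ⊆ column R? (σ i₀) - i₀
    shrink i∈column with ∈-setOf⁻ (λ i → avoidingMatching? i (σ i₀)) i∈column
    ... | Riσi₀ , σi₀≢σi =
      x∈p∧x≢y⇒x∈p-y (∈-setOf⁺ (λ i → R? i (σ i₀)) Riσi₀) (λ { refl → σi₀≢σi refl })

injective⇒surjective : ∀ {m n} {f : Fin m → Fin n} → m ≡ n → Injective _≡_ _≡_ f →
                        ∀ y → ∃ λ x → f x ≡ y
injective⇒surjective {suc m} {f = f} refl f-injective y with any? (λ x → f x ≟ y)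
... | yes found  = found
... | no  missed = contradiction (injective⇒≤ punchOut-injective′) 1+n≰n
  where
  y≢f : ∀ x → y ≢ f x
  y≢f x y≡fx = missed (x , sym y≡fx)

  punchOut-injective′ : Injective _≡_ _≡_ (λ x → punchOut (y≢f x))
  punchOut-injective′ {x} {x′} eq = f-injective (punchOut-injective (y≢f x) (y≢f x′) eq)

-- Orbits of a permutation of Fin n

leastWitness : ∀ {P : U.Pred ℕ 0ℓ} → U.Decidable P → ∀ {m} → P m →
               ∃ λ k → P k × (∀ {j} → j < k → ¬ P j)
leastWitness {P} P? {m} Pm = search m Pm (<-wellFounded m)
  where
  search : ∀ m → P m → Acc _<_ m → ∃ λ k → P k × (∀ {j} → j < k → ¬ P j)
  search m Pm (acc rec) with any? (λ (j : Fin m) → P? (toℕ j))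
  ... | yes (j , Pj) = search (toℕ j) Pj (rec (toℕ<n j))
  ... | no  none     = m , Pm , λ j<m Pj →
    none (fromℕ< j<m , subst P (sym (toℕ-fromℕ< j<m)) Pj)

module Orbits {n : ℕ} (π : Fin n → Fin n) (π-injective : Injective _≡_ _≡_ π) where

  π^ : ℕ → Fin n → Fin n
  π^ k x = iterate π x k

  π^-+ : ∀ i j x → π^ (i + j) x ≡ π^ j (π^ i x)
  π^-+ zero    j x = refl
  π^-+ (suc i) j x = π^-+ i j (π x)

  π^-comm : ∀ i j x → π^ i (π^ j x) ≡ π^ j (π^ i x)
  π^-comm i j x = begin
    π^ i (π^ j x)  ≡⟨ π^-+ j i x ⟨
    π^ (j + i) x   ≡⟨ cong (λ k → π^ k x) (+-comm j i) ⟩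
    π^ (i + j) x   ≡⟨ π^-+ i j x ⟩
    π^ j (π^ i x)  ∎
    where open ≡-Reasoning

  π^-injective : ∀ k {x y} → π^ k x ≡ π^ k y → x ≡ y
  π^-injective zero    eq = eq
  π^-injective (suc k) eq = π-injective (π^-injective k eq)

  π^-cancel : ∀ i d x → π^ i x ≡ π^ (i + d) x → π^ d x ≡ x
  π^-cancel i d x eq = sym (π^-injective i (begin
    π^ i x         ≡⟨ eq ⟩
    π^ (i + d) x   ≡⟨ π^-+ i d x ⟩
    π^ d (π^ i x)  ≡⟨ π^-comm i d x ⟨
    π^ i (π^ d x)  ∎))
    where open ≡-Reasoning

  π^-cancel-< : ∀ {i j} x → i < j → π^ i x ≡ π^ j x → π^ (j ∸ i) x ≡ x
  π^-cancel-< {i} {j} x i<j eq =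
    π^-cancel i (j ∸ i) x (trans eq (cong (λ k → π^ k x) (sym (m+[n∸m]≡n (<⇒≤ i<j)))))

  Returns : Fin n → U.Pred ℕ 0ℓ
  Returns x k = 0 < k × π^ k x ≡ x

  returns : ∀ x → ∃ (Returns x)
  returns x with pigeonhole (n<1+n n) (λ (k : Fin (suc n)) → π^ (toℕ k) x)
  ... | i , j , i<j , eq = toℕ j ∸ toℕ i , m<n⇒0<n∸m i<j , π^-cancel-< x i<j eq

  -- Opaque: unfolding the search for the least return time blows up type checking.
  opaque
    minimalReturn : ∀ x → ∃ λ p → Returns x p × (∀ {j} → j < p → ¬ Returns x j)
    minimalReturn x = leastWitness (λ k → 0 <? k ×-dec π^ k x ≟ x) (proj₂ (returns x))

  period : Fin n → ℕ
  period x = proj₁ (minimalReturn x)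

  0<period : ∀ x → 0 < period x
  0<period x = proj₁ (proj₁ (proj₂ (minimalReturn x)))

  π^period : ∀ x → π^ (period x) x ≡ x
  π^period x = proj₂ (proj₁ (proj₂ (minimalReturn x)))

  period-minimal : ∀ {x j} → 0 < j → j < period x → π^ j x ≢ x
  period-minimal {x} 0<j j<p eq = proj₂ (proj₂ (minimalReturn x)) j<p (0<j , eq)

  π^-injectiveBelowPeriod : ∀ {x i j} → i < period x → j < period x → π^ i x ≡ π^ j x → i ≡ j
  π^-injectiveBelowPeriod {x} {i} {j} i<p j<p eq with <-cmp i j
  ... | tri≈ _ i≡j _ = i≡j
  ... | tri< i<j _ _ = contradiction (π^-cancel-< x i<j eq)
                         (period-minimal (m<n⇒0<n∸m i<j) (≤-<-trans (m∸n≤m j i) j<p))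
  ... | tri> _ _ j<i = contradiction (π^-cancel-< x j<i (sym eq))
                         (period-minimal (m<n⇒0<n∸m j<i) (≤-<-trans (m∸n≤m i j) i<p))

  private instance
    period-nonZero : ∀ {x} → NonZero (period x)
    period-nonZero {x} = >-nonZero (0<period x)

  module _ {x : Fin n} where

    π^-multiple : ∀ m → π^ (m * period x) x ≡ x
    π^-multiple zero    = refl
    π^-multiple (suc m) = begin
      π^ (period x + m * period x) x     ≡⟨ π^-+ (period x) (m * period x) x ⟩
      π^ (m * period x) (π^ (period x) x) ≡⟨ cong (π^ (m * period x)) (π^period x) ⟩
      π^ (m * period x) x                ≡⟨ π^-multiple m ⟩
      x                                  ∎
      where open ≡-Reasoning

    π^-mod : ∀ k → π^ k x ≡ π^ (k % period x) x
    π^-mod k = begin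
      π^ k x                               ≡⟨ cong (λ m → π^ m x) (m≡m%n+[m/n]*n k (period x)) ⟩
      π^ (k % p + (k / p) * p) x           ≡⟨ π^-+ (k % p) ((k / p) * p) x ⟩
      π^ ((k / p) * p) (π^ (k % p) x)      ≡⟨ π^-comm ((k / p) * p) (k % p) x ⟩
      π^ (k % p) (π^ ((k / p) * p) x)      ≡⟨ cong (π^ (k % p)) (π^-multiple (k / p)) ⟩
      π^ (k % p) x                         ∎
      where
      open ≡-Reasoning
      p : ℕ
      p = period x

  infix 4 _↝_
  _↝_ : Fin n → Fin n → Set
  x ↝ y = ∃ λ k → π^ k x ≡ y

  ↝-refl : ∀ {x} → x ↝ x
  ↝-refl = 0 , refl

  ↝-trans : ∀ {x y z} → x ↝ y → y ↝ z → x ↝ z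
  ↝-trans {x} (i , refl) (j , refl) = i + j , π^-+ i j x

  ↝-belowPeriod : ∀ {x y} → x ↝ y → ∃ λ k → k < period x × π^ k x ≡ y
  ↝-belowPeriod {x} (k , refl) = k % period x , m%n<n k (period x) , sym (π^-mod k)

  ↝-sym : ∀ {x y} → x ↝ y → y ↝ x
  ↝-sym {x} x↝y with ↝-belowPeriod x↝y
  ... | k , k<p , refl = period x ∸ k , (begin
    π^ (period x ∸ k) (π^ k x)  ≡⟨ π^-+ k (period x ∸ k) x ⟨
    π^ (k + (period x ∸ k)) x   ≡⟨ cong (λ m → π^ m x) (m+[n∸m]≡n (<⇒≤ k<p)) ⟩
    π^ (period x) x             ≡⟨ π^period x ⟩
    x                           ∎)
    where open ≡-Reasoning

  Leader : Fin n → Set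
  Leader x = ∀ {y} → x ↝ y → x ≤ᶠ y

  leader-unique : ∀ {ℓ ℓ′ y} → Leader ℓ → Leader ℓ′ → ℓ ↝ y → ℓ′ ↝ y → ℓ ≡ ℓ′
  leader-unique leader leader′ ℓ↝y ℓ′↝y =
    ≤ᶠ-antisym (leader (↝-trans ℓ↝y (↝-sym ℓ′↝y))) (leader′ (↝-trans ℓ′↝y (↝-sym ℓ↝y)))

  private
    LeaderBelowPeriod : Fin n → Set
    LeaderBelowPeriod x = ∀ (k : Fin (period x)) → x ≤ᶠ π^ (toℕ k) x

    leader-belowPeriod : ∀ {x} → LeaderBelowPeriod x → Leader x
    leader-belowPeriod {x} leader x↝y with ↝-belowPeriod x↝y
    ... | k , k<p , refl = subst (λ m → x ≤ᶠ π^ m x) (toℕ-fromℕ< k<p) (leader (fromℕ< k<p))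

  leader? : U.Decidable Leader
  leader? x = map′ leader-belowPeriod (λ leader k → leader (toℕ k , refl))
                   (all? (λ k → x ≤ᶠ? π^ (toℕ k) x))

  leader-exists : ∀ x → ∃ λ ℓ → Leader ℓ × ℓ ↝ x
  leader-exists x = descend x ↝-refl (<-wellFounded (toℕ x))
    where
    descend : ∀ y → y ↝ x → Acc _<_ (toℕ y) → ∃ λ ℓ → Leader ℓ × ℓ ↝ x
    descend y y↝x (acc rec) with leader? y
    ... | yes leader = y , leader , y↝x
    ... | no ¬leader with ¬∀⟶∃¬ _ _ (λ k → y ≤ᶠ? π^ (toℕ k) y) (¬leader ∘ leader-belowPeriod)
    ...   | k , y≰ = descend (π^ (toℕ k) y) (↝-trans (↝-sym (toℕ k , refl)) y↝x) (rec (≰⇒> y≰))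

-- Closed trails from a cycle system

lookup-injective : ∀ {A : Set} {xs : List A} → Unique xs → ∀ i j → lookup xs i ≡ lookup xs j → i ≡ j
lookup-injective (_ ∷ _)      zero    zero    _  = refl
lookup-injective (x∉xs ∷ _)   zero    (suc j) eq = contradiction eq (All.lookup x∉xs (∈-lookup j))
lookup-injective (x∉xs ∷ _)   (suc i) zero    eq = contradiction (sym eq) (All.lookup x∉xs (∈-lookup i))
lookup-injective (_ ∷ unique) (suc i) (suc j) eq = cong suc (lookup-injective unique i j eq)

record CycleSystem (H : Hypergraph) : Set where
  field
    next           : V H → V H
    via            : V H → E H
    next-injective : Injective _≡_ _≡_ next
    via-injective  : Injective _≡_ _≡_ via
    via-surjective : ∀ e → ∃ λ v → via v ≡ e
    next-≢         : ∀ v → v ≢ next v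
    ∈-via          : ∀ v → v ∈ Hypergraph.edge H (via v)
    next-∈-via     : ∀ v → next v ∈ Hypergraph.edge H (via v)

module _ {H : Hypergraph} (C : CycleSystem H) where
  open CycleSystem C
  open Orbits next next-injective

  stepsFrom : V H → ℕ → List (E H × V H)
  stepsFrom x zero    = []
  stepsFrom x (suc k) = (via x , next x) ∷ stepsFrom (next x) k

  cycleAt : V H → Walk H
  cycleAt x = walk x (stepsFrom x (period x))

  stepsFrom-valid : ∀ k x → ValidSteps H x (stepsFrom x k)
  stepsFrom-valid zero    x = []
  stepsFrom-valid (suc k) x = (next-≢ x , ∈-via x , next-∈-via x) ∷ stepsFrom-valid k (next x)

  length-stepsFrom : ∀ k x → length (stepsFrom x k) ≡ k
  length-stepsFrom zero    x = refl
  length-stepsFrom (suc k) x = cong suc (length-stepsFrom k (next x))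

  endpoint-stepsFrom : ∀ k x → endpoint H x (stepsFrom x k) ≡ π^ k x
  endpoint-stepsFrom zero    x = refl
  endpoint-stepsFrom (suc k) x = endpoint-stepsFrom k (next x)

  ∈-edges⁻ : ∀ k x {e} → e List.∈ map proj₁ (stepsFrom x k) → ∃ λ i → i < k × e ≡ via (π^ i x)
  ∈-edges⁻ (suc k) x (here e≡via)  = 0 , s≤s z≤n , e≡via
  ∈-edges⁻ (suc k) x (there e∈) with ∈-edges⁻ k (next x) e∈
  ... | i , i<k , e≡via = suc i , s≤s i<k , e≡via

  ∈-edges⁺ : ∀ k x {i} → i < k → via (π^ i x) List.∈ map proj₁ (stepsFrom x k)
  ∈-edges⁺ (suc k) x {zero}  _         = here refl
  ∈-edges⁺ (suc k) x {suc i} (s≤s i<k) = there (∈-edges⁺ k (next x) i<k)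

  ∈-anchors⁻ : ∀ k x {v} → v List.∈ anchors H (walk x (stepsFrom x k)) → x ↝ v
  ∈-anchors⁻ k       x (here refl)          = ↝-refl
  ∈-anchors⁻ (suc k) x (there (here refl))  = 1 , refl
  ∈-anchors⁻ (suc k) x (there (there v∈))   = ↝-trans (1 , refl) (∈-anchors⁻ k (next x) (there v∈))

  edges-unique : ∀ k x → (∀ {i j} → i < k → j < k → π^ i x ≡ π^ j x → i ≡ j) →
                 Unique (map proj₁ (stepsFrom x k))
  edges-unique zero    x distinct = []
  edges-unique (suc k) x distinct =
    All.tabulate first-fresh ∷ edges-unique k (next x) distinct′
    where
    distinct′ : ∀ {i j} → i < k → j < k → π^ i (next x) ≡ π^ j (next x) → i ≡ j
    distinct′ i<k j<k eq = suc-injective (distinct (s≤s i<k) (s≤s j<k) eq)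

    first-fresh : ∀ {e} → e List.∈ map proj₁ (stepsFrom (next x) k) → via x ≢ e
    first-fresh e∈ via≡e with ∈-edges⁻ k (next x) e∈
    ... | i , i<k , e≡via = 0≢1+n (distinct (s≤s z≤n) (s≤s i<k) (via-injective (trans via≡e e≡via)))

  2≤period : ∀ x → 2 ≤ period x
  2≤period x with period x | 0<period x | π^period x
  ... | suc zero    | _ | returns = contradiction (sym returns) (next-≢ x)
  ... | suc (suc _) | _ | _       = s≤s (s≤s z≤n)

  cycleAt-closedStrictTrail : ∀ x → IsClosedStrictTrail H (cycleAt x)
  cycleAt-closedStrictTrail x =
    (stepsFrom-valid (period x) x , edges-unique (period x) x π^-injectiveBelowPeriod) ,
    subst (2 ≤_) (sym (length-stepsFrom (period x) x)) (2≤period x) ,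
    trans (endpoint-stepsFrom (period x) x) (π^period x)

  leaders : List (V H)
  leaders = filter leader? (allFin _)

  cycles : List (Walk H)
  cycles = map cycleAt leaders

  cycles-unique : Unique cycles
  cycles-unique = Unique.map⁺ (cong Walk.start) (Unique.filter⁺ leader? (Unique.allFin⁺ _))

  cycles-lookup : ∀ i → ∃ λ ℓ → Leader ℓ × lookup cycles i ≡ cycleAt ℓ
  cycles-lookup i =
    let ℓ , ℓ∈leaders , eq = ∈-map⁻ cycleAt (∈-lookup {xs = cycles} i)
    in  ℓ , proj₂ (∈-filter⁻ leader? {xs = allFin _} ℓ∈leaders) , eq

  anchor-determinesLeader : ∀ {ℓ ℓ′ v} → Leader ℓ → Leader ℓ′ →
                            v List.∈ anchors H (cycleAt ℓ) → v List.∈ anchors H (cycleAt ℓ′) → ℓ ≡ ℓ′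
  anchor-determinesLeader {ℓ} {ℓ′} leader leader′ v∈ v∈′ =
    leader-unique leader leader′ (∈-anchors⁻ (period ℓ) ℓ v∈) (∈-anchors⁻ (period ℓ′) ℓ′ v∈′)

  edge-determinesLeader : ∀ {ℓ ℓ′ e} → Leader ℓ → Leader ℓ′ →
                          e List.∈ edgesOf H (cycleAt ℓ) → e List.∈ edgesOf H (cycleAt ℓ′) → ℓ ≡ ℓ′
  edge-determinesLeader {ℓ} {ℓ′} leader leader′ e∈ e∈′ =
    let c  , _ , e≡via  = ∈-edges⁻ (period ℓ) ℓ e∈
        c′ , _ , e≡via′ = ∈-edges⁻ (period ℓ′) ℓ′ e∈′
    in  leader-unique leader leader′ (c , refl) (c′ , sym (via-injective (trans (sym e≡via) e≡via′)))

  edge-onSomeCycle : ∀ e → ∃ λ ℓ → Leader ℓ × e List.∈ edgesOf H (cycleAt ℓ)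
  edge-onSomeCycle e =
    let v , via≡e         = via-surjective e
        ℓ , leader , ℓ↝v  = leader-exists v
        c , c<period , eq = ↝-belowPeriod ℓ↝v
    in  ℓ , leader , subst (λ e′ → e′ List.∈ edgesOf H (cycleAt ℓ)) (trans (cong via eq) via≡e)
                             (∈-edges⁺ (period ℓ) ℓ c<period)

  cycles-anchorDisjoint : ∀ i j → i ≢ j → AnchorDisjoint H (lookup cycles i) (lookup cycles j)
  cycles-anchorDisjoint i j i≢j v v∈i v∈j =
    let ℓ  , leader  , eq  = cycles-lookup i
        ℓ′ , leader′ , eq′ = cycles-lookup j
        same = anchor-determinesLeader leader leader′
                 (subst (λ w → v List.∈ anchors H w) eq v∈i) (subst (λ w → v List.∈ anchors H w) eq′ v∈j)
    in  i≢j (lookup-injective cycles-unique i j (trans eq (trans (cong cycleAt same) (sym eq′))))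

  CoveredOnce : E H → Set
  CoveredOnce e = Σ (Fin (length cycles)) λ i →
    e List.∈ edgesOf H (lookup cycles i) × (∀ j → e List.∈ edgesOf H (lookup cycles j) → j ≡ i)

  coveredOnce-onCycle : ∀ {e ℓ} → Leader ℓ → e List.∈ edgesOf H (cycleAt ℓ) → CoveredOnce e
  coveredOnce-onCycle {e} {ℓ} leader e∈ =
    index ℓ∈cycles , subst (λ w → e List.∈ edgesOf H w) at-index e∈ , only
    where
    ℓ∈cycles : cycleAt ℓ List.∈ cycles
    ℓ∈cycles = ∈-map⁺ cycleAt (∈-filter⁺ leader? (∈-allFin ℓ) leader)

    at-index : cycleAt ℓ ≡ lookup cycles (index ℓ∈cycles)
    at-index = lookup-index ℓ∈cycles

    only : ∀ j → e List.∈ edgesOf H (lookup cycles j) → j ≡ index ℓ∈cycles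
    only j e∈j =
      let z , leaderz , eq = cycles-lookup j
          same = edge-determinesLeader leaderz leader (subst (λ w → e List.∈ edgesOf H w) eq e∈j) e∈
      in  lookup-injective cycles-unique j _ (trans eq (trans (cong cycleAt same) at-index))

  cycles-cover : ∀ e → CoveredOnce e
  cycles-cover e = let _ , leader , e∈ = edge-onSomeCycle e in coveredOnce-onCycle leader e∈

  cycles-closedStrictTrail : ∀ i → IsClosedStrictTrail H (lookup cycles i)
  cycles-closedStrictTrail i =
    let ℓ , _ , eq = cycles-lookup i
    in  subst (IsClosedStrictTrail H) (sym eq) (cycleAt-closedStrictTrail ℓ)

  cycleSystem⇒quasiEulerian : QuasiEulerian H
  cycleSystem⇒quasiEulerian = cycles , cycles-closedStrictTrail , cycles-anchorDisjoint , cycles-cover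

-- Perfect matchings of regular uniform hypergraphs

record PerfectMatching (H : Hypergraph) : Set where
  field
    match            : V H → E H
    match-injective  : Injective _≡_ _≡_ match
    match-surjective : ∀ e → ∃ λ v → match v ≡ e
    ∈-match          : ∀ v → v ∈ Hypergraph.edge H (match v)

module _ {H : Hypergraph} (M N : PerfectMatching H) where
  private
    module M = PerfectMatching M
    module N = PerfectMatching N

  disjointMatchings⇒cycleSystem : (∀ v → N.match v ≢ M.match v) → CycleSystem H
  disjointMatchings⇒cycleSystem N≢M = record
    { next           = next
    ; via            = N.match
    ; next-injective = next-injective
    ; via-injective  = N.match-injective
    ; via-surjective = N.match-surjective
    ; next-≢         = λ v v≡next → N≢M v (trans (sym (M∘next v)) (cong M.match (sym v≡next)))
    ; ∈-via          = N.∈-match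
    ; next-∈-via     = λ v → subst (λ e → next v ∈ Hypergraph.edge H e) (M∘next v) (M.∈-match (next v))
    }
    where
    next : V H → V H
    next v = proj₁ (M.match-surjective (N.match v))

    M∘next : ∀ v → M.match (next v) ≡ N.match v
    M∘next v = proj₂ (M.match-surjective (N.match v))

    next-injective : Injective _≡_ _≡_ next
    next-injective {v} {v′} eq =
      N.match-injective (trans (sym (M∘next v)) (trans (cong M.match eq) (M∘next v′)))

module _ (H : Hypergraph) where
  open Hypergraph H
  open PerfectMatching

  incident? : Decidable (λ (v : V H) (e : E H) → v ∈ edge e)
  incident? v e = v ∈? edge e

  ∣row∣≡degree : ∀ v → ∣ row incident? v ∣ ≡ degree H v
  ∣row∣≡degree v = sym (length-filter-tabulate (λ e → v ∈? edge e) (λ e → e))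

  ∣column∣≡∣edge∣ : ∀ e → ∣ column incident? e ∣ ≡ ∣ edge e ∣
  ∣column∣≡∣edge∣ e = trans (∣setOf∣≡∑ (λ v → v ∈? edge e)) (sym (∣p∣≡∑ (edge e)))

  module _ {k : ℕ} .{{_ : NonZero k}} (regular : Regular H k) (uniform : Uniform H k) where

    private
      k≤∣row∣ : ∀ v → k ≤ ∣ row incident? v ∣
      k≤∣row∣ v = ≤-reflexive (sym (trans (∣row∣≡degree v) (regular v)))

      ∣row∣≤k : ∀ v → ∣ row incident? v ∣ ≤ k
      ∣row∣≤k v = ≤-reflexive (trans (∣row∣≡degree v) (regular v))

      k≤∣column∣ : ∀ e → k ≤ ∣ column incident? e ∣
      k≤∣column∣ e = ≤-reflexive (sym (trans (∣column∣≡∣edge∣ e) (uniform e)))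

      ∣column∣≤k : ∀ e → ∣ column incident? e ∣ ≤ k
      ∣column∣≤k e = ≤-reflexive (trans (∣column∣≡∣edge∣ e) (uniform e))

    |V|≡|E| : suc nv ≡ ne
    |V|≡|E| = cantor-schröder-bernstein
      (proj₂ (proj₂ (biregularMatching incident? k k≤∣row∣ ∣column∣≤k)))
      (proj₂ (proj₂ (biregularMatching (flip incident?) k k≤∣column∣ ∣row∣≤k)))

    perfectMatching : PerfectMatching H
    perfectMatching =
      let σ , incident , injective = biregularMatching incident? k k≤∣row∣ ∣column∣≤k
      in  record { match = σ ; match-injective = injective
                 ; match-surjective = injective⇒surjective |V|≡|E| injective ; ∈-match = incident }

  disjointPerfectMatching : ∀ {k} → Regular H (2 + k) → Uniform H (2 + k) → (M : PerfectMatching H) →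
                            Σ (PerfectMatching H) λ N → ∀ v → match N v ≢ match M v
  disjointPerfectMatching {k} regular uniform M =
    let τ , avoiding , injective = biregularMatching avoiding? (suc k) rows columns
    in  record { match = τ ; match-injective = injective
               ; match-surjective = injective⇒surjective (|V|≡|E| regular uniform) injective
               ; ∈-match = λ v → proj₁ (avoiding v) } ,
        λ v → proj₂ (avoiding v)
    where
    avoiding? : Decidable (AvoidingMatching incident? (match M))
    avoiding? = avoidingMatching? incident? (match M)

    rows : ∀ v → suc k ≤ ∣ row avoiding? v ∣
    rows v = ≤-pred (begin
      2 + k                         ≡⟨ trans (∣row∣≡degree v) (regular v) ⟨
      ∣ row incident? v ∣           ≤⟨ ∣row∣-avoidingMatching incident? (match M) v ⟩
      suc ∣ row avoiding? v ∣       ∎)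
      where open ≤-Reasoning

    columns : ∀ e → ∣ column avoiding? e ∣ ≤ suc k
    columns e = ≤-pred (begin-strict
      ∣ column avoiding? e ∣        <⟨ ∣column∣-avoidingMatching incident? (match M) (∈-match M) (match-surjective M) e ⟩
      ∣ column incident? e ∣        ≡⟨ trans (∣column∣≡∣edge∣ e) (uniform e) ⟩
      2 + k                         ∎)
      where open ≤-Reasoning

mainTheorem9 : (r : ℕ) → r ≥ 2 → (H : Hypergraph) →
    Regular H r → Uniform H r → QuasiEulerian H
mainTheorem9 (suc (suc k)) _ H regular uniform =
  let M      = perfectMatching H regular uniform
      N , N≢M = disjointPerfectMatching H regular uniform M
  in  cycleSystem⇒quasiEulerian (disjointMatchings⇒cycleSystem M N N≢M)
mainTheorem9 1 (s≤s ())
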